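{- Let $B$ be a once-appearance branching program computing $\gamma'_n$, and let $\ell_1,\ell_2,\dots,\ell_{3n}$ be the labels of the non-sink nodes of $B$ listed in a topological order. Then for every $i\in\{0,\dots,n-1\}$ we have $\{\ell_{3i+1},\ell_{3i+2},\ell_{3i+3}\}=\{x_a,y_b,z_b\}$ for some $a,b\in[n]$.
   Context: The partial function $\gamma'_n:\{0,1\}^{3n}\to\{0,1,*\}$ on variables $\vec x=(x_1,\dots,x_n)$, $\vec y=(y_1,\dots,y_n)$, $\vec z=(z_1,\dots,z_n)$ is: $\bigvee_{i}(y_i\land z_i)$ if $\vec x=0^n$; $\bigvee_i z_i$ if $\vec x=1^n$; $\bigvee_i(x_i\lor y_i)$ if $\vec z=1^n$; $0$ if $\vec z=0^n$; and $*$ otherwise (these cases agree where they overlap). A branching program (BP) on Boolean variables is a directed acyclic graph with one source and two sinks labeled $0$ and $1$; each non-sink node is labeled by a variable and has two outgoing edges labeled $0$ and $1$; it computes by following, from the source, the edge labeled with the current node's variable value until a sink is reached. A once-appearance branching program (oaBP) is a BP whose non-sink node labels are pairwise distinct. A BP computes a partial function if it agrees with it on all inputs where it is not $*$. A topological order lists the non-sink nodes so that every edge goes from an earlier node to a later one. -}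

module Defs where

open import Data.Nat using (ℕ; zero; suc; _*_; _<_)
open import Data.Fin using (Fin; zero; suc; toℕ; combine)
open import Data.Bool using (Bool; true; false; _∧_; _∨_; not; if_then_else_)
open import Data.Maybe using (Maybe; just; nothing)
open import Data.Sum using (_⊎_; inj₁; inj₂)
open import Data.Product using (Σ; ∃; ∃-syntax; _×_; _,_)
open import Relation.Binary.PropositionalEquality using (_≡_; _≢_)

-- The 3n Boolean variables x_1..x_n, y_1..y_n, z_1..z_n (indices 0-based via Fin n).
data Var (n : ℕ) : Set where
  x : Fin n → Var n
  y : Fin n → Var n
  z : Fin n → Var n

Input : ℕ → Set
Input n = Var n → Bool

orF : ∀ {n} → (Fin n → Bool) → Bool
orF {zero}  f = false
orF {suc n} f = f zero ∨ orF (λ i → f (suc i))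

andF : ∀ {n} → (Fin n → Bool) → Bool
andF {zero}  f = true
andF {suc n} f = f zero ∧ andF (λ i → f (suc i))

-- The partial function γ'_n ; nothing encodes the value *.
-- (The cases agree on overlaps, so checking them in this order is faithful.)
gamma' : ∀ n → Input n → Maybe Bool
gamma' n a =
  if andF (λ i → not (a (x i))) then just (orF (λ i → a (y i) ∧ a (z i)))
  else if andF (λ i → a (x i)) then just (orF (λ i → a (z i)))
  else if andF (λ i → a (z i)) then just (orF (λ i → a (x i) ∨ a (y i)))
  else if andF (λ i → not (a (z i))) then just false
  else nothing

-- Targets of edges: a non-sink node (Fin m) or a sink labelled by a Bool.
Target : ℕ → Set
Target m = Fin m ⊎ Bool

-- A branching program on Var n with m non-sink nodes, where the non-sink
-- nodes are indexed 0..m-1 in a topological order (every edge between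
-- non-sink nodes goes from a smaller to a larger index).
record BP (n m : ℕ) : Set where
  field
    label   : Fin m → Var n
    next    : Fin m → Bool → Target m
    source  : Target m
    forward : ∀ i b j → next i b ≡ inj₁ j → toℕ i < toℕ j
    onlySource : ∀ j → inj₁ j ≢ source → ∃[ i ] ∃[ b ] (next i b ≡ inj₁ j)
open BP public

data Reaches {n m : ℕ} (B : BP n m) (a : Input n) : Target m → Bool → Set where
  sink : ∀ r → Reaches B a (inj₂ r) r
  step : ∀ i r → Reaches B a (next B i (a (label B i))) r → Reaches B a (inj₁ i) r

Computes : ∀ {n m} → BP n m → (Input n → Maybe Bool) → Set
Computes {n} B f = ∀ (a : Input n) (r : Bool) → f a ≡ just r → Reaches B a (source B) r

OnceAppearance : ∀ {n m} → BP n m → Set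
OnceAppearance {m = m} B = ∀ (i j : Fin m) → label B i ≡ label B j → i ≡ j

-- The block {ℓ_{3i+1}, ℓ_{3i+2}, ℓ_{3i+3}} (0-based nodes 3i, 3i+1, 3i+2),
-- as a set, equals {x_a, y_b, z_b}.
InBlock : ∀ {n} → BP n (n * 3) → Fin n → Var n → Set
InBlock B i v = ∃[ k ] (label B (combine i k) ≡ v)

InTriple : ∀ {n} → Var n → Var n → Var n → Var n → Set
InTriple v p q r = (v ≡ p) ⊎ (v ≡ q) ⊎ (v ≡ r)

BlockIs : ∀ {n} → BP n (n * 3) → Fin n → Fin n → Fin n → Set
BlockIs B i a b =
  (∀ k → InTriple (label B (combine i k)) (x a) (y b) (z b))
  × InBlock B i (x a) × InBlock B i (y b) × InBlock B i (z b)

module Submission where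

open import Defs
open import Data.Nat using (ℕ; _*_)
open import Data.Fin using (Fin)
open import Data.Product using (∃-syntax)

open import Data.Bool as Bool using (Bool; true; false; _∧_; _∨_; not)
open import Data.Bool.Properties using (∨-zeroʳ; not-involutive)
open import Data.Empty using (⊥; ⊥-elim)
open import Data.Fin as Fin using (toℕ; combine; fromℕ<)
open import Data.Fin.Properties
  using (any?; combine-injective; injective⇒≤; punchOut-injective; toℕ<n; toℕ-injective; toℕ-fromℕ<; toℕ-combine)
open import Data.Maybe using (just)
open import Data.Nat using (zero; suc; _+_; _∸_; _<_; _≤_; _<?_; s≤s⁻¹; z<s)
open import Data.Nat.Properties
  using ( ≤-refl; ≤-reflexive; ≤-trans; ≤-antisym; <-trans; <-irrefl; <-asym; <⇒≤; ≤∧≢⇒<; <-≤-trans; ≤-<-trans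
        ; <-cmp; ≮⇒≥; n≮0; 1+n≰n; n<1+n; n≤1+n; m≤n⇒m<n∨m≡n; m<1+n⇒m≤n; m≤m+n; m≤n+m; m<n+m; suc-injective
        ; +-comm; +-monoʳ-<; *-comm; *-suc; *-zeroʳ; *-monoʳ-<; m+[n∸m]≡n; m<n+o⇒m∸n<o)
open import Data.Product using (∃; _×_; _,_; proj₁; proj₂)
open import Data.Sum using (_⊎_; inj₁; inj₂)
open import Data.Sum.Properties using (≡-dec)
open import Function using (_∘_)
open import Function.Definitions using (Injective)
open import Relation.Binary.Definitions using (DecidableEquality; tri<; tri≈; tri>)
open import Relation.Binary.PropositionalEquality
open import Relation.Nullary using (yes; no; does; ¬_; contradiction)
open import Relation.Nullary.Decidable using (map′; dec-true; dec-false)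

-- Every variable labels exactly one of the 3n nodes, so the topological order is an order on the variables.
-- Two facts about a program computing γ'ₙ drive the proof: if flipping v changes the output, the computation
-- passes through the node of v; and two inputs that pass through a common node and agree on every variable
-- from there on have the same output.  Applied to inputs that are constant on the x's (where γ'ₙ is ⋁ (yᵢ ∧ zᵢ)
-- or ⋁ zᵢ) or that set all z's (where it is ⋁ (xᵢ ∨ yᵢ)), they show: no y_j, z_j lies strictly between y_d and
-- z_d; an adjacent pair y_d z_d is immediately preceded by an x and an adjacent pair z_d y_d immediately
-- followed by one; and z_d y_d x y_e z_e never occurs.  So every pair j gets an x next to it, injectively and
-- hence bijectively; a pair that is not adjacent therefore encloses exactly one x, and the n triples
-- {x_ψj, y_j, z_j} fill disjoint windows of three consecutive positions, which can only be the blocks.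

module _ {J : Set} {m : ℕ} (b : ℕ) (start : J → ℕ)
  (cover : ∀ q → q < m * suc b → ∃ λ j → start j ≤ q × q < suc b + start j)
  (unique : ∀ {j k q} → start j ≤ q → q < suc b + start j → start k ≤ q → q < suc b + start k → j ≡ k)
  where

  window-starting-at : ∀ q → q < m * suc b → (∀ {j} → start j < q → q < suc b + start j → ⊥) →
                       ∃ λ j → start j ≡ q
  window-starting-at q q<mw not-earlier with cover q q<mw
  ... | j , sj≤q , q<w+sj with m≤n⇒m<n∨m≡n sj≤q
  ...   | inj₂ sj≡q = j , sj≡q
  ...   | inj₁ sj<q = ⊥-elim (not-earlier sj<q q<w+sj)

  aligned-windows : ∀ i → i < m → ∃ λ j → start j ≡ suc b * i
  aligned-windows i i<m =
    window-starting-at (suc b * i) (subst (suc b * i <_) (*-comm (suc b) m) (*-monoʳ-< (suc b) i<m)) (not-earlier i i<m)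
    where
    not-earlier : ∀ i → i < m → ∀ {j} → start j < suc b * i → suc b * i < suc b + start j → ⊥
    not-earlier zero    _   {j} sj<0 _ = n≮0 (subst (start j <_) (*-zeroʳ (suc b)) sj<0)
    not-earlier (suc i) i<m {j} sj<q q<w+sj with aligned-windows i (<-trans (n<1+n i) i<m)
    ... | k , sk≡wi =
      <-irrefl (*-suc (suc b) i) (subst (λ s → suc b * suc i < suc b + s) (trans (cong start j≡k) sk≡wi) q<w+sj)
      where
      p : ℕ
      p = b + suc b * i
      q≡1+p : suc b * suc i ≡ suc p
      q≡1+p = *-suc (suc b) i
      j≡k : j ≡ k
      j≡k = unique (m<1+n⇒m≤n (subst (start j <_) q≡1+p sj<q)) (<-trans (subst (p <_) (sym q≡1+p) (n<1+n p)) q<w+sj)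
                   (subst (_≤ p) (sym sk≡wi) (m≤n+m (suc b * i) b)) (subst (λ s → p < suc b + s) (sym sk≡wi) (n<1+n p))

two-after : ∀ {m k} → m < k → k ≤ 2 + m → k ≡ 1 + m ⊎ k ≡ 2 + m
two-after m<k k≤2+m with m≤n⇒m<n∨m≡n k≤2+m
... | inj₂ k≡2+m = inj₂ k≡2+m
... | inj₁ k<2+m = inj₁ (≤-antisym (s≤s⁻¹ k<2+m) m<k)

three-after : ∀ {m k} → m < k → k ≤ 3 + m → k ≡ 1 + m ⊎ k ≡ 2 + m ⊎ k ≡ 3 + m
three-after m<k k≤3+m with m≤n⇒m<n∨m≡n k≤3+m
... | inj₂ k≡3+m = inj₂ (inj₂ k≡3+m)
... | inj₁ k<3+m with two-after m<k (s≤s⁻¹ k<3+m)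
...   | inj₁ k≡1+m = inj₁ k≡1+m
...   | inj₂ k≡2+m = inj₂ (inj₁ k≡2+m)

injective⇒surjective : ∀ {m} (f : Fin m → Fin m) → Injective _≡_ _≡_ f → ∀ b → ∃ λ i → f i ≡ b
injective⇒surjective {suc m} f f-injective b with any? (λ i → f i Fin.≟ b)
... | yes hit = hit
... | no  miss = ⊥-elim (1+n≰n (injective⇒≤ {f = avoiding-b} avoiding-b-injective))
  where
  b≢f : ∀ i → b ≢ f i
  b≢f i e = miss (i , sym e)
  avoiding-b : Fin (suc m) → Fin m
  avoiding-b i = Fin.punchOut (b≢f i)
  avoiding-b-injective : Injective _≡_ _≡_ avoiding-b
  avoiding-b-injective e = f-injective (punchOut-injective (b≢f _) (b≢f _) e)

module _ {n : ℕ} where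

  index : Var n → Fin n
  index (x i) = i
  index (y i) = i
  index (z i) = i

  tag : Var n → Fin 3
  tag (x _) = Fin.zero
  tag (y _) = Fin.suc Fin.zero
  tag (z _) = Fin.suc (Fin.suc Fin.zero)

  index-tag-injective : ∀ {v w : Var n} → index v ≡ index w → tag v ≡ tag w → v ≡ w
  index-tag-injective {x _} {x _} refl _ = refl
  index-tag-injective {y _} {y _} refl _ = refl
  index-tag-injective {z _} {z _} refl _ = refl
  index-tag-injective {x _} {y _} _ ()
  index-tag-injective {x _} {z _} _ ()
  index-tag-injective {y _} {x _} _ ()
  index-tag-injective {y _} {z _} _ ()
  index-tag-injective {z _} {x _} _ ()
  index-tag-injective {z _} {y _} _ ()

  encode : Var n → Fin (n * 3)
  encode v = combine (index v) (tag v)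

  encode-injective : Injective _≡_ _≡_ encode
  encode-injective {v} {w} e =
    let i≡j , k≡l = combine-injective (index v) (tag v) (index w) (tag w) e
    in index-tag-injective i≡j k≡l

  -- Defined clause by clause so that comparing variables of different kinds computes to no; this is what
  -- makes most NoX and AllX side conditions below hold by refl.
  infix 4 _≟ᵛ_
  _≟ᵛ_ : DecidableEquality (Var n)
  x i ≟ᵛ x j = map′ (cong x) (cong index) (i Fin.≟ j)
  y i ≟ᵛ y j = map′ (cong y) (cong index) (i Fin.≟ j)
  z i ≟ᵛ z j = map′ (cong z) (cong index) (i Fin.≟ j)
  x _ ≟ᵛ y _ = no λ ()
  x _ ≟ᵛ z _ = no λ ()
  y _ ≟ᵛ x _ = no λ ()
  y _ ≟ᵛ z _ = no λ ()
  z _ ≟ᵛ x _ = no λ ()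
  z _ ≟ᵛ y _ = no λ ()

  pv : Fin n → Bool → Var n
  pv j true  = y j
  pv j false = z j

  index-pv : ∀ j s → index (pv j s) ≡ j
  index-pv j true  = refl
  index-pv j false = refl

  pv-index : ∀ {j k s t} → pv j s ≡ pv k t → j ≡ k
  pv-index {j} {k} {s} {t} e = trans (sym (index-pv j s)) (trans (cong index e) (index-pv k t))

false≢true : false ≢ true
false≢true ()

andF-true : ∀ {n} (f : Fin n → Bool) → (∀ i → f i ≡ true) → andF f ≡ true
andF-true {zero}  f all = refl
andF-true {suc n} f all rewrite all Fin.zero = andF-true (λ i → f (Fin.suc i)) (λ i → all (Fin.suc i))

andF-true⁻¹ : ∀ {n} (f : Fin n → Bool) → andF f ≡ true → ∀ i → f i ≡ true
andF-true⁻¹ {suc n} f all i with f Fin.zero in f0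
andF-true⁻¹ {suc n} f all Fin.zero    | true = f0
andF-true⁻¹ {suc n} f all (Fin.suc i) | true = andF-true⁻¹ (λ j → f (Fin.suc j)) all i

andF-false : ∀ {n} (f : Fin n → Bool) i → f i ≡ false → andF f ≡ false
andF-false {suc n} f Fin.zero    fi rewrite fi = refl
andF-false {suc n} f (Fin.suc i) fi with f Fin.zero
... | true  = andF-false (λ j → f (Fin.suc j)) i fi
... | false = refl

orF-true : ∀ {n} (f : Fin n → Bool) i → f i ≡ true → orF f ≡ true
orF-true {suc n} f Fin.zero    fi rewrite fi = refl
orF-true {suc n} f (Fin.suc i) fi with f Fin.zero
... | true  = refl
... | false = orF-true (λ j → f (Fin.suc j)) i fi

orF-false : ∀ {n} (f : Fin n → Bool) → (∀ i → f i ≡ false) → orF f ≡ false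
orF-false {zero}  f none = refl
orF-false {suc n} f none rewrite none Fin.zero = orF-false (λ i → f (Fin.suc i)) (λ i → none (Fin.suc i))

gamma'-allX : ∀ {n} (a : Input n) → (∀ i → a (x i) ≡ true) → gamma' n a ≡ just (orF λ i → a (z i))
gamma'-allX {zero}  a all-x = refl
gamma'-allX {suc n} a all-x
  rewrite andF-false (λ i → not (a (x i))) Fin.zero (cong not (all-x Fin.zero))
        | andF-true (λ i → a (x i)) all-x = refl

module Inputs {n : ℕ} where

  ∅ allX allZ : Input n
  ∅ _ = false

  allX (x _) = true
  allX (y _) = false
  allX (z _) = false

  allZ (x _) = false
  allZ (y _) = false
  allZ (z _) = true

  infixl 6 _∪⁅_⁆
  _∪⁅_⁆ : Input n → Var n → Input n
  (a ∪⁅ v ⁆) w = does (w ≟ᵛ v) ∨ a w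

  ∪-self : ∀ a v → (a ∪⁅ v ⁆) v ≡ true
  ∪-self a v rewrite dec-true (v ≟ᵛ v) refl = refl

  ∪-mono : ∀ a w v → a w ≡ true → (a ∪⁅ v ⁆) w ≡ true
  ∪-mono a w v aw rewrite aw = ∨-zeroʳ (does (w ≟ᵛ v))

  ∪-other : ∀ a {v w} → w ≢ v → (a ∪⁅ v ⁆) w ≡ a w
  ∪-other a {v} {w} w≢v rewrite dec-false (w ≟ᵛ v) w≢v = refl

  ∪-true⁻¹ : ∀ a {v w} → (a ∪⁅ v ⁆) w ≡ true → w ≡ v ⊎ a w ≡ true
  ∪-true⁻¹ a {v} {w} on with w ≟ᵛ v
  ... | yes w≡v = inj₁ w≡v
  ... | no  _   = inj₂ on

  DifferOnlyAt : Var n → Input n → Input n → Set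
  DifferOnlyAt v a a′ = ∀ w → w ≢ v → a w ≡ a′ w

  differOnlyAt-sym : ∀ {v a a′} → DifferOnlyAt v a a′ → DifferOnlyAt v a′ a
  differOnlyAt-sym d w w≢v = sym (d w w≢v)

  ∪-differOnlyAt : ∀ a v → DifferOnlyAt v a (a ∪⁅ v ⁆)
  ∪-differOnlyAt a v w w≢v = sym (∪-other a w≢v)

  ∪-cong-differOnlyAt : ∀ {v a a′} u → DifferOnlyAt v a a′ → DifferOnlyAt v (a ∪⁅ u ⁆) (a′ ∪⁅ u ⁆)
  ∪-cong-differOnlyAt u d w w≢v = cong (does (w ≟ᵛ u) ∨_) (d w w≢v)

  NoX AllX Incomplete : Input n → Set
  NoX a = ∀ i → a (x i) ≡ false
  AllX a = ∀ i → a (x i) ≡ true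
  Incomplete a = ∀ i → a (y i) ≡ true → a (z i) ≡ true → ⊥

  noX-∪-pv : ∀ a j s → NoX a → NoX (a ∪⁅ pv j s ⁆)
  noX-∪-pv a j true  noX = noX
  noX-∪-pv a j false noX = noX

  incomplete-singleton : ∀ v → Incomplete (∅ ∪⁅ v ⁆)
  incomplete-singleton v i yi zi with ∪-true⁻¹ ∅ {v} {y i} yi | ∪-true⁻¹ ∅ {v} {z i} zi
  ... | inj₁ refl | inj₁ ()

  incomplete-pair : ∀ u v → index u ≢ index v → Incomplete (∅ ∪⁅ u ⁆ ∪⁅ v ⁆)
  incomplete-pair u v u≁v i yi zi with ∪-true⁻¹ (∅ ∪⁅ u ⁆) {v} {y i} yi | ∪-true⁻¹ (∅ ∪⁅ u ⁆) {v} {z i} zi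
  ... | inj₁ refl | inj₁ ()
  ... | inj₁ refl | inj₂ zi′ with ∪-true⁻¹ ∅ {u} {z i} zi′
  ...   | inj₁ refl = u≁v refl
  incomplete-pair u v u≁v i yi zi | inj₂ yi′ | inj₁ refl with ∪-true⁻¹ ∅ {u} {y i} yi′
  ...   | inj₁ refl = u≁v refl
  incomplete-pair u v u≁v i yi zi | inj₂ yi′ | inj₂ zi′ = incomplete-singleton u i yi′ zi′

  gamma'-noX : ∀ a → NoX a → gamma' n a ≡ just (orF λ i → a (y i) ∧ a (z i))
  gamma'-noX a noX rewrite andF-true (λ i → not (a (x i))) (λ i → cong not (noX i)) = refl

  noX-true : ∀ a → NoX a → ∀ i → a (y i) ≡ true → a (z i) ≡ true → gamma' n a ≡ just true
  noX-true a noX i yi zi = trans (gamma'-noX a noX) (cong just (orF-true _ i (cong₂ _∧_ yi zi)))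

  noX-true-pv : ∀ a → NoX a → ∀ j t → a (pv j t) ≡ true → a (pv j (not t)) ≡ true → gamma' n a ≡ just true
  noX-true-pv a noX j true  on on′ = noX-true a noX j on on′
  noX-true-pv a noX j false on on′ = noX-true a noX j on′ on

  noX-false : ∀ a → NoX a → Incomplete a → gamma' n a ≡ just false
  noX-false a noX incomplete = trans (gamma'-noX a noX) (cong just (orF-false _ pair-off))
    where
    pair-off : ∀ i → a (y i) ∧ a (z i) ≡ false
    pair-off i with a (y i) in yi | a (z i) in zi
    ... | false | _     = refl
    ... | true  | false = refl
    ... | true  | true  = ⊥-elim (incomplete i yi zi)

  allX-true : ∀ a → AllX a → ∀ i → a (z i) ≡ true → gamma' n a ≡ just true
  allX-true a all-x i zi = trans (gamma'-allX a all-x) (cong just (orF-true _ i zi))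

  allX-false : ∀ a → AllX a → (∀ i → a (z i) ≡ false) → gamma' n a ≡ just false
  allX-false a all-x no-z = trans (gamma'-allX a all-x) (cong just (orF-false _ no-z))

  allZ-true : ∀ a → (∀ i → a (z i) ≡ true) → ∀ i → a (x i) ∨ a (y i) ≡ true → gamma' n a ≡ just true
  allZ-true a all-z i xy with andF (λ j → not (a (x j))) in noX
  ... | true  = cong just (orF-true _ i (cong₂ _∧_ y-on (all-z i)))
    where
    y-on : a (y i) ≡ true
    y-on with a (x i) in xi
    ... | false = xy
    ... | true  = contradiction (andF-true⁻¹ _ noX i) (subst (λ b → not b ≢ true) (sym xi) λ ())
  ... | false with andF (λ j → a (x j))
  ...   | true  = cong just (orF-true _ i (all-z i))
  ...   | false rewrite andF-true (λ j → a (z j)) all-z = cong just (orF-true _ i xy)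

module Paths {n m : ℕ} (B : BP n m) where
  open Inputs {n}

  rank : Target m → ℕ
  rank (inj₁ k) = toℕ k
  rank (inj₂ _) = m

  data Path (a : Input n) : Target m → Target m → Set where
    here : ∀ {t} → Path a t t
    step : ∀ {k t} → Path a (next B k (a (label B k))) t → Path a (inj₁ k) t

  rank-next : ∀ k b → toℕ k < rank (next B k b)
  rank-next k b with next B k b in e
  ... | inj₁ j = forward B k b j e
  ... | inj₂ _ = toℕ<n k

  path-rank : ∀ {a t u} → Path a t u → rank t ≤ rank u
  path-rank here         = ≤-refl
  path-rank (step {k} p) = ≤-trans (<⇒≤ (rank-next k _)) (path-rank p)

  path-trans : ∀ {a t u w} → Path a t u → Path a u w → Path a t w
  path-trans here     q = q
  path-trans (step p) q = step (path-trans p q)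

  path-continue : ∀ {a s k u} → Path a s (inj₁ k) → Path a s u → toℕ k < rank u →
                  Path a (next B k (a (label B k))) u
  path-continue here     here     k<u = ⊥-elim (<-irrefl refl k<u)
  path-continue here     (step q) k<u = q
  path-continue (step p) here     k<u = ⊥-elim (<-irrefl refl (<-≤-trans k<u (path-rank (step p))))
  path-continue (step p) (step q) k<u = path-continue p q k<u

  path-agree : ∀ {a a′ t u} → Path a t u →
               (∀ k → rank t ≤ toℕ k → toℕ k < rank u → a (label B k) ≡ a′ (label B k)) → Path a′ t u
  path-agree here agree = here
  path-agree {a} {a′} {u = u} (step {k} p) agree =
    step (subst (λ b → Path a′ (next B k b) u) (agree k ≤-refl (≤-trans (rank-next k _) (path-rank p)))
           (path-agree p λ j k<j j<u → agree j (<⇒≤ (<-≤-trans (rank-next k _) k<j)) j<u))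

  reaches-from : ∀ {a t u r} → Path a t u → Reaches B a u r → Reaches B a t r
  reaches-from here     R = R
  reaches-from (step p) R = step _ _ (reaches-from p R)

  reaches-after : ∀ {a t u r} → Reaches B a t r → Path a t u → Reaches B a u r
  reaches-after R            here     = R
  reaches-after (step _ _ R) (step p) = reaches-after R p

  reaches-functional : ∀ {a t r r′} → Reaches B a t r → Reaches B a t r′ → r ≡ r′
  reaches-functional (sink _)     (sink _)      = refl
  reaches-functional (step _ _ R) (step _ _ R′) = reaches-functional R R′

  reaches-agree : ∀ {a a′ t r} → Reaches B a t r →
                  (∀ k → rank t ≤ toℕ k → a (label B k) ≡ a′ (label B k)) → Reaches B a′ t r
  reaches-agree (sink r) agree = sink r
  reaches-agree {a} {a′} (step k r R) agree =
    step k r (subst (λ b → Reaches B a′ (next B k b) r) (agree k ≤-refl)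
               (reaches-agree R λ j k<j → agree j (<⇒≤ (<-≤-trans (rank-next k _) k<j))))

  reads-or-reaches : ∀ {a a′ t r} v → Reaches B a t r → DifferOnlyAt v a a′ →
                     (∃[ k ] label B k ≡ v × Path a t (inj₁ k)) ⊎ Reaches B a′ t r
  reads-or-reaches v (sink r) d = inj₂ (sink r)
  reads-or-reaches {a} {a′} v (step k r R) d with label B k ≟ᵛ v
  ... | yes lk≡v = inj₁ (k , lk≡v , here)
  ... | no  lk≢v with reads-or-reaches v R d
  ...   | inj₁ (j , lj≡v , p) = inj₁ (j , lj≡v , step p)
  ...   | inj₂ R′ = inj₂ (step k r (subst (λ b → Reaches B a′ (next B k b) r) (d _ lk≢v) R′))

  source-first : ∀ k → toℕ k ≡ 0 → source B ≡ inj₁ k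
  source-first k k≡0 with ≡-dec Fin._≟_ Bool._≟_ (inj₁ k) (source B)
  ... | yes k≡src = sym k≡src
  ... | no  k≢src with onlySource B k k≢src
  ...   | i , b , e = ⊥-elim (n≮0 (subst (toℕ i <_) k≡0 (forward B i b k e)))

module Reading {n : ℕ} (B : BP n (n * 3)) (oa : OnceAppearance B) (comp : Computes B (gamma' n)) where
  open Inputs {n}
  open Paths B

  -- Kept abstract so that the pigeonhole proof inside never unfolds in goals.
  abstract
    node : Var n → Fin (n * 3)
    node v = proj₁ (injective⇒surjective (encode ∘ label B) (oa _ _ ∘ encode-injective) (encode v))

    label-node : ∀ v → label B (node v) ≡ v
    label-node v = encode-injective (proj₂ (injective⇒surjective (encode ∘ label B) (oa _ _ ∘ encode-injective) (encode v)))

  node-label : ∀ k → node (label B k) ≡ k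
  node-label k = oa _ _ (label-node (label B k))

  pos : Var n → ℕ
  pos v = toℕ (node v)

  pos-label : ∀ k → pos (label B k) ≡ toℕ k
  pos-label k = cong toℕ (node-label k)

  pos-injective : ∀ {v w} → pos v ≡ pos w → v ≡ w
  pos-injective {v} {w} e = trans (sym (label-node v)) (trans (cong (label B) (toℕ-injective e)) (label-node w))

  pos<n*3 : ∀ v → pos v < n * 3
  pos<n*3 v = toℕ<n (node v)

  label-at : ∀ {k v} → toℕ k ≡ pos v → label B k ≡ v
  label-at {k} {v} e = trans (cong (label B) (toℕ-injective e)) (label-node v)

  var-at : ∀ {q} → q < n * 3 → ∃ λ v → pos v ≡ q
  var-at q<3n = label B (fromℕ< q<3n) , trans (pos-label _) (toℕ-fromℕ< q<3n)

  first-or-after : ∀ v → pos v ≡ 0 ⊎ ∃ λ w → pos v ≡ suc (pos w)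
  first-or-after v with pos v in e
  ... | zero  = inj₁ refl
  ... | suc q with var-at (<-trans (n<1+n q) (subst (_< n * 3) e (pos<n*3 v)))
  ...   | w , w≡q = inj₂ (w , cong suc (sym w≡q))

  last-or-before : ∀ v → (∀ w → pos v ≤ pos w → w ≡ v) ⊎ ∃ λ w → pos w ≡ suc (pos v)
  last-or-before v with suc (pos v) <? n * 3
  ... | yes v+1<3n = inj₂ (var-at v+1<3n)
  ... | no  v-last = inj₁ λ w v≤w →
    pos-injective (≤-antisym (≮⇒≥ λ v<w → v-last (≤-<-trans v<w (pos<n*3 w))) v≤w)

  record Reads (a : Input n) (v : Var n) : Set where
    constructor reads
    field path : Path a (source B) (inj₁ (node v))

  record Edge (u : Var n) (b : Bool) (v : Var n) : Set where
    constructor edge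
    field next≡ : next B (node u) b ≡ inj₁ (node v)

  reads-first : ∀ {a v} → pos v ≡ 0 → Reads a v
  reads-first {a} {v} v≡0 = reads (subst (λ t → Path a t (inj₁ (node v))) (sym (source-first (node v) v≡0)) here)

  reads-edge : ∀ {a u v} → Reads a u → Edge u (a u) v → Reads a v
  reads-edge {a} {u} {v} (reads ru) (edge e) =
    reads (path-trans ru (step (subst (λ t → Path a t (inj₁ (node v))) (sym e′) here)))
    where
    e′ : next B (node u) (a (label B (node u))) ≡ inj₁ (node v)
    e′ = subst (λ w → next B (node u) (a w) ≡ inj₁ (node v)) (sym (label-node u)) e

  edge-forward : ∀ {u b v} → Edge u b v → pos u < pos v
  edge-forward {u} {b} {v} (edge e) = forward B (node u) b (node v) e

  edge-within : ∀ {a u w} → Reads a u → Reads a w → pos u < pos w →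
                ∃ λ v → Edge u (a u) v × pos u < pos v × pos v ≤ pos w
  edge-within {a} {u} {w} (reads ru) (reads rw) u<w
    with next B (node u) (a (label B (node u))) in e | path-continue ru rw u<w
  ... | inj₁ k | p = label B k , edge u→k , subst (pos u <_) (sym (pos-label k)) (forward B (node u) _ k e)
                               , subst (_≤ pos w) (sym (pos-label k)) (path-rank p)
    where
    u→k : next B (node u) (a u) ≡ inj₁ (node (label B k))
    u→k = trans (subst (λ v → next B (node u) (a v) ≡ inj₁ k) (label-node u) e) (cong inj₁ (sym (node-label k)))

  edge-adjacent : ∀ {a u v} → Reads a u → Reads a v → pos v ≡ suc (pos u) → Edge u (a u) v
  edge-adjacent {a} {u} {v} ru rv v≡1+u with edge-within ru rv (≤-reflexive (sym v≡1+u))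
  ... | v′ , e , u<v′ , v′≤v =
    subst (Edge u (a u)) (pos-injective (≤-antisym v′≤v (subst (_≤ pos v′) (sym v≡1+u) u<v′))) e

  reads-sensitive : ∀ {a a′ r} v → DifferOnlyAt v a a′ →
                    gamma' n a ≡ just r → gamma' n a′ ≡ just (not r) → Reads a v
  reads-sensitive {a} {a′} {r} v d γa γa′ with reads-or-reaches v (comp a r γa) d
  ... | inj₁ (k , lk≡v , p) =
    reads (subst (λ k → Path a (source B) (inj₁ k)) (trans (sym (node-label k)) (cong node lk≡v)) p)
  ... | inj₂ R′ = ⊥-elim (not-fixed r (reaches-functional R′ (comp a′ (not r) γa′)))
    where
    not-fixed : ∀ r → r ≢ not r
    not-fixed true  ()
    not-fixed false ()

  same-value-after : ∀ {a a′ v r r′} → Reads a v → Reads a′ v → (∀ w → pos v ≤ pos w → a w ≡ a′ w) →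
                     gamma' n a ≡ just r → gamma' n a′ ≡ just r′ → r ≡ r′
  same-value-after {a} {a′} {v} {r} {r′} (reads ra) (reads ra′) agree γa γa′ =
    reaches-functional (reaches-from ra′ (reaches-agree (reaches-after (comp a r γa) ra) agree′)) (comp a′ r′ γa′)
    where
    agree′ : ∀ k → pos v ≤ toℕ k → a (label B k) ≡ a′ (label B k)
    agree′ k v≤k = agree (label B k) (subst (pos v ≤_) (sym (pos-label k)) v≤k)

  same-value-if-differ-before : ∀ {a a′ v w r r′} → Reads a v → Reads a′ v → DifferOnlyAt w a a′ → pos w < pos v →
                                gamma' n a ≡ just r → gamma' n a′ ≡ just r′ → r ≡ r′
  same-value-if-differ-before ra ra′ d w<v =
    same-value-after ra ra′ λ u v≤u → d u λ { refl → <-irrefl refl (<-≤-trans w<v v≤u) }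

  reads-transfer : ∀ {a a′ v w} → Reads a v → DifferOnlyAt w a a′ → pos v ≤ pos w → Reads a′ v
  reads-transfer (reads ra) d v≤w = reads (path-agree ra λ k _ k<v →
    d (label B k) λ { refl → <-irrefl refl (<-≤-trans k<v (subst (_ ≤_) (pos-label k) v≤w)) })

  path-between : ∀ {a u v} → Reads a u → Reads a v → pos u ≤ pos v → Path a (inj₁ (node u)) (inj₁ (node v))
  path-between (reads ru) (reads rv) u≤v with m≤n⇒m<n∨m≡n u≤v
  ... | inj₁ u<v = step (path-continue ru rv u<v)
  ... | inj₂ u≡v rewrite pos-injective u≡v = here

  reads-along : ∀ {a a′ u v} → Reads a u → Reads a v → pos u ≤ pos v → Reads a′ u →
                (∀ w → pos u ≤ pos w → pos w < pos v → a w ≡ a′ w) → Reads a′ v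
  reads-along {u = u} {v} ru rv u≤v (reads ru′) agree =
    reads (path-trans ru′ (path-agree (path-between ru rv u≤v) λ k u≤k k<v →
      agree (label B k) (subst (pos u ≤_) (sym (pos-label k)) u≤k) (subst (_< pos v) (sym (pos-label k)) k<v)))

module Unnested {n : ℕ} (pos : Var n → ℕ)
  (pairs-unnested : ∀ {d j} → d ≢ j → ∀ s t → pos (pv d s) < pos (pv j t) → pos (pv j t) < pos (pv d (not s)) → ⊥)
  where

  no-pair-var-inside : ∀ j s k t → pos (pv j s) < pos (pv k t) → pos (pv k t) < pos (pv j (not s)) → ⊥
  no-pair-var-inside j s k t l r with j Fin.≟ k
  ... | no j≢k = pairs-unnested j≢k s t l r
  no-pair-var-inside j true  k true  l r | yes refl = <-irrefl refl l
  no-pair-var-inside j true  k false l r | yes refl = <-irrefl refl r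
  no-pair-var-inside j false k true  l r | yes refl = <-irrefl refl r
  no-pair-var-inside j false k false l r | yes refl = <-irrefl refl l

  only-x-inside-pair : ∀ j s w → pos (pv j s) < pos w → pos w < pos (pv j (not s)) → ∃ λ i → w ≡ x i
  only-x-inside-pair j s (x i) _ _ = i , refl
  only-x-inside-pair j s (y k) l r = ⊥-elim (no-pair-var-inside j s k true l r)
  only-x-inside-pair j s (z k) l r = ⊥-elim (no-pair-var-inside j s k false l r)

module Ordering {n : ℕ} (B : BP n (n * 3)) (oa : OnceAppearance B) (comp : Computes B (gamma' n)) where
  open Inputs {n}
  open Reading B oa comp

  reads-flip : ∀ a v {r} → gamma' n a ≡ just r → gamma' n (a ∪⁅ v ⁆) ≡ just (not r) →
               Reads a v × Reads (a ∪⁅ v ⁆) v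
  reads-flip a v {r} γa γa+v =
    reads-sensitive v (∪-differOnlyAt a v) γa γa+v ,
    reads-sensitive v (differOnlyAt-sym (∪-differOnlyAt a v)) γa+v
      (subst (λ b → gamma' n a ≡ just b) (sym (not-involutive r)) γa)

  reads-flip-under : ∀ a v u {r} →
                     gamma' n (a ∪⁅ u ⁆) ≡ just r → gamma' n (a ∪⁅ v ⁆ ∪⁅ u ⁆) ≡ just (not r) →
                     Reads (a ∪⁅ u ⁆) v × Reads (a ∪⁅ v ⁆ ∪⁅ u ⁆) v
  reads-flip-under a v u {r} γa+u γa+v+u =
    reads-sensitive v differ γa+u γa+v+u ,
    reads-sensitive v (differOnlyAt-sym differ) γa+v+u
      (subst (λ b → gamma' n (a ∪⁅ u ⁆) ≡ just b) (sym (not-involutive r)) γa+u)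
    where
    differ : DifferOnlyAt v (a ∪⁅ u ⁆) (a ∪⁅ v ⁆ ∪⁅ u ⁆)
    differ = ∪-cong-differOnlyAt u (∪-differOnlyAt a v)

  value-allX : gamma' n allX ≡ just false
  value-allX = allX-false allX (λ _ → refl) (λ _ → refl)

  value-y : ∀ j → gamma' n (∅ ∪⁅ y j ⁆) ≡ just false
  value-y j = noX-false (∅ ∪⁅ y j ⁆) (λ _ → refl) (incomplete-singleton (y j))

  value-z : ∀ j → gamma' n (∅ ∪⁅ z j ⁆) ≡ just false
  value-z j = noX-false (∅ ∪⁅ z j ⁆) (λ _ → refl) (incomplete-singleton (z j))

  value-yz : ∀ j → gamma' n (∅ ∪⁅ y j ⁆ ∪⁅ z j ⁆) ≡ just true
  value-yz j = noX-true (∅ ∪⁅ y j ⁆ ∪⁅ z j ⁆) (λ _ → refl) j (∪-self ∅ (y j)) (∪-self (∅ ∪⁅ y j ⁆) (z j))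

  value-zy : ∀ j → gamma' n (∅ ∪⁅ z j ⁆ ∪⁅ y j ⁆) ≡ just true
  value-zy j = noX-true (∅ ∪⁅ z j ⁆ ∪⁅ y j ⁆) (λ _ → refl) j (∪-self (∅ ∪⁅ z j ⁆) (y j)) (∪-self ∅ (z j))

  reads-z-without-z : ∀ a → AllX a → (∀ i → a (z i) ≡ false) → ∀ j → Reads a (z j)
  reads-z-without-z a all-x no-z j =
    proj₁ (reads-flip a (z j) (allX-false a all-x no-z) (allX-true (a ∪⁅ z j ⁆) all-x j (∪-self a (z j))))

  allX-reads-z : ∀ j → Reads allX (z j)
  allX-reads-z = reads-z-without-z allX (λ _ → refl) (λ _ → refl)

  allZ-reads-non-z : ∀ v → (∀ j → v ≢ z j) → Reads allZ v
  allZ-reads-non-z v v≢z =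
    proj₁ (reads-flip allZ v (noX-false allZ (λ _ → refl) (λ _ ()))
                             (allZ-true (allZ ∪⁅ v ⁆) (λ i → ∪-mono allZ (z i) v refl) (index v) (x-or-y-on v v≢z)))
    where
    x-or-y-on : ∀ v → (∀ j → v ≢ z j) → (allZ ∪⁅ v ⁆) (x (index v)) ∨ (allZ ∪⁅ v ⁆) (y (index v)) ≡ true
    x-or-y-on (x i) _   rewrite ∪-self allZ (x i) = refl
    x-or-y-on (y i) _   = ∪-self allZ (y i)
    x-or-y-on (z i) v≢z = ⊥-elim (v≢z i refl)

  y-reads-z : ∀ j → Reads (∅ ∪⁅ y j ⁆) (z j)
  y-reads-z j = proj₁ (reads-flip (∅ ∪⁅ y j ⁆) (z j) (value-y j) (value-yz j))

  y-reads-own-y : ∀ {j} → pos (y j) < pos (z j) → Reads (∅ ∪⁅ y j ⁆) (y j)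
  y-reads-own-y {j} y<z = reads-transfer (proj₂ (reads-flip-under ∅ (y j) (z j) (value-z j) (value-yz j)))
                                         (differOnlyAt-sym (∪-differOnlyAt (∅ ∪⁅ y j ⁆) (z j))) (<⇒≤ y<z)

  later-y-unread : ∀ {j} → pos (z j) < pos (y j) → ¬ Reads (∅ ∪⁅ y j ⁆) (y j)
  later-y-unread {j} z<y ry = false≢true
    (same-value-if-differ-before ry (proj₂ (reads-flip-under ∅ (y j) (z j) (value-z j) (value-yz j)))
                                 (∪-differOnlyAt _ (z j)) z<y (value-y j) (value-yz j))

  y-reads-other-pair : ∀ {j d} → j ≢ d → ∀ s → pos (pv d s) < pos (pv d (not s)) → Reads (∅ ∪⁅ y j ⁆) (pv d s)
  y-reads-other-pair {j} {d} j≢d s s<s̄ =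
    reads-transfer (proj₁ (reads-flip a (pv d s) γa γa+s))
                   (differOnlyAt-sym (∪-differOnlyAt (∅ ∪⁅ y j ⁆) (pv d (not s)))) (<⇒≤ s<s̄)
    where
    a : Input n
    a = ∅ ∪⁅ y j ⁆ ∪⁅ pv d (not s) ⁆
    γa : gamma' n a ≡ just false
    γa = noX-false a (noX-∪-pv (∅ ∪⁅ y j ⁆) d (not s) λ _ → refl)
                     (incomplete-pair (y j) (pv d (not s)) λ e → j≢d (trans e (index-pv d (not s))))
    γa+s : gamma' n (a ∪⁅ pv d s ⁆) ≡ just true
    γa+s = noX-true-pv (a ∪⁅ pv d s ⁆) (noX-∪-pv a d s (noX-∪-pv (∅ ∪⁅ y j ⁆) d (not s) λ _ → refl)) d s
                       (∪-self a (pv d s)) (∪-mono a (pv d (not s)) (pv d s) (∪-self (∅ ∪⁅ y j ⁆) (pv d (not s))))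

  zz-reads-yy : ∀ {d k} → d ≢ k →
                Reads (∅ ∪⁅ z d ⁆ ∪⁅ z k ⁆) (y d) × Reads (∅ ∪⁅ z d ⁆ ∪⁅ z k ⁆) (y k)
  zz-reads-yy {d} {k} d≢k = proj₁ (reads-flip a (y d) γa γa+yd) , proj₁ (reads-flip a (y k) γa γa+yk)
    where
    a : Input n
    a = ∅ ∪⁅ z d ⁆ ∪⁅ z k ⁆
    γa : gamma' n a ≡ just false
    γa = noX-false a (λ _ → refl) (λ _ ())
    γa+yd : gamma' n (a ∪⁅ y d ⁆) ≡ just true
    γa+yd = noX-true (a ∪⁅ y d ⁆) (λ _ → refl) d (∪-self a (y d))
                     (∪-mono (∅ ∪⁅ z d ⁆) (z d) (z k) (∪-self ∅ (z d)))
    γa+yk : gamma' n (a ∪⁅ y k ⁆) ≡ just true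
    γa+yk = noX-true (a ∪⁅ y k ⁆) (λ _ → refl) k (∪-self a (y k)) (∪-self (∅ ∪⁅ z d ⁆) (z k))

  y-false-edge-avoids-z : ∀ d → ¬ Edge (y d) false (z d)
  y-false-edge-avoids-z d y→z = false≢true
    (same-value-if-differ-before (reads-edge (proj₁ (reads-flip (∅ ∪⁅ z d ⁆) (y d) (value-z d) (value-zy d))) y→z)
                                 (proj₂ (reads-flip-under ∅ (z d) (y d) (value-y d) (value-zy d)))
                                 (∪-differOnlyAt (∅ ∪⁅ z d ⁆) (y d)) (edge-forward y→z) (value-z d) (value-zy d))

  -- Both ∅ ∪ v̄ and ∅ ∪ v̄ ∪ w read v, since v completes the pair j; adding w̄, which comes after v, keeps
  -- this, but then the two inputs differ only at w, before v, while one completes the pair d and the other does not.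
  pairs-unnested : ∀ {d j} → d ≢ j → ∀ s t → pos (pv d s) < pos (pv j t) → pos (pv j t) < pos (pv d (not s)) → ⊥
  pairs-unnested {d} {j} d≢j s t w<v v<w̄ =
    false≢true (same-value-if-differ-before A′+w̄-reads A+w̄-reads differ w<v γA′+w̄ γA+w̄)
    where
    w w̄ v v̄ : Var n
    w = pv d s ; w̄ = pv d (not s) ; v = pv j t ; v̄ = pv j (not t)
    A′ A : Input n
    A′ = ∅ ∪⁅ v̄ ⁆
    A  = A′ ∪⁅ w ⁆
    noX-A′ : NoX A′
    noX-A′ = noX-∪-pv ∅ j (not t) (λ _ → refl)
    noX-A : NoX A
    noX-A = noX-∪-pv A′ d s noX-A′
    apart : ∀ s t → index (pv j t) ≢ index (pv d s)
    apart s t e rewrite index-pv j t | index-pv d s = d≢j (sym e)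
    γA′ : gamma' n A′ ≡ just false
    γA′ = noX-false A′ noX-A′ (incomplete-singleton v̄)
    γA′+v : gamma' n (A′ ∪⁅ v ⁆) ≡ just true
    γA′+v = noX-true-pv (A′ ∪⁅ v ⁆) (noX-∪-pv A′ j t noX-A′) j t
                        (∪-self A′ v) (∪-mono A′ v̄ v (∪-self ∅ v̄))
    γA : gamma' n A ≡ just false
    γA = noX-false A noX-A (incomplete-pair v̄ w (apart s (not t)))
    γA+v : gamma' n (A ∪⁅ v ⁆) ≡ just true
    γA+v = noX-true-pv (A ∪⁅ v ⁆) (noX-∪-pv A j t noX-A) j t
                       (∪-self A v) (∪-mono A v̄ v (∪-mono A′ v̄ w (∪-self ∅ v̄)))
    γA+w̄ : gamma' n (A ∪⁅ w̄ ⁆) ≡ just true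
    γA+w̄ = noX-true-pv (A ∪⁅ w̄ ⁆) (noX-∪-pv A d (not s) noX-A) d s (∪-mono A w w̄ (∪-self A′ w)) (∪-self A w̄)
    γA′+w̄ : gamma' n (A′ ∪⁅ w̄ ⁆) ≡ just false
    γA′+w̄ = noX-false (A′ ∪⁅ w̄ ⁆) (noX-∪-pv A′ d (not s) noX-A′) (incomplete-pair v̄ w̄ (apart (not s) (not t)))
    A+w̄-reads : Reads (A ∪⁅ w̄ ⁆) v
    A+w̄-reads = reads-transfer (proj₁ (reads-flip A v γA γA+v)) (∪-differOnlyAt A w̄) (<⇒≤ v<w̄)
    A′+w̄-reads : Reads (A′ ∪⁅ w̄ ⁆) v
    A′+w̄-reads = reads-transfer (proj₁ (reads-flip A′ v γA′ γA′+v)) (∪-differOnlyAt A′ w̄) (<⇒≤ v<w̄)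
    differ : DifferOnlyAt w (A′ ∪⁅ w̄ ⁆) (A ∪⁅ w̄ ⁆)
    differ = ∪-cong-differOnlyAt w̄ (∪-differOnlyAt A′ w)

  open Unnested pos pairs-unnested

  adjacent-yz-unread : ∀ {d a} → pos (z d) ≡ suc (pos (y d)) → Reads a (y d) → a (y d) ≡ false → ¬ Reads a (z d)
  adjacent-yz-unread {d} adj ry y-off rz =
    y-false-edge-avoids-z d (subst (λ b → Edge (y d) b (z d)) y-off (edge-adjacent ry rz adj))

  allX-avoids-y : ∀ {d} → pos (z d) ≡ suc (pos (y d)) → ¬ Reads allX (y d)
  allX-avoids-y {d} adj ry = adjacent-yz-unread adj ry refl (allX-reads-z d)

  z-false-edge-avoids-y : ∀ {d} → pos (z d) ≡ suc (pos (y d)) → ∀ j → ¬ Edge (z j) false (y d)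
  z-false-edge-avoids-y adj j z→y = allX-avoids-y adj (reads-edge (allX-reads-z j) z→y)

  z-before-y-right-before-y : ∀ {j d} → j ≢ d → pos (y d) ≡ suc (pos (y j)) → pos (z j) < pos (y j)
  z-before-y-right-before-y {j} {d} j≢d yd≡1+yj with <-cmp (pos (z j)) (pos (y j))
  ... | tri< z<y _ _ = z<y
  ... | tri≈ _ z≡y _ with () ← pos-injective z≡y
  ... | tri> _ _ y<z = ⊥-elim (pairs-unnested j≢d true true (≤-reflexive (sym yd≡1+yj)) yd<zj)
    where
    yd<zj : pos (y d) < pos (z j)
    yd<zj = ≤∧≢⇒< (subst (_≤ pos (z j)) (sym yd≡1+yj) y<z) λ yd≡zj → y≢z (pos-injective yd≡zj)
      where y≢z : y d ≢ z j
            y≢z ()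

  module AdjacentYZ {d} (adj : pos (z d) ≡ suc (pos (y d))) where

    y<z : pos (y d) < pos (z d)
    y<z = ≤-reflexive (sym adj)

    no-z-right-before : ∀ {j} → pos (y d) ≡ suc (pos (z j)) → ⊥
    no-z-right-before {j} yd≡1+zj =
      z-false-edge-avoids-y adj j (edge-adjacent (y-reads-z j) (y-reads-other-pair j≢d true y<z) yd≡1+zj)
      where
      j≢d : j ≢ d
      j≢d refl = <-asym y<z (≤-reflexive (sym yd≡1+zj))

    -- ∅ ∪ y j reads z j and y d; its 0-edge out of z j cannot go to y d, so it enters the x's between z j and
    -- y j, from where it follows allZ to y j, which it must not read.
    no-y-right-before : ∀ {j} → pos (y d) ≡ suc (pos (y j)) → ⊥
    no-y-right-before {j} yd≡1+yj = from-edge (edge-within (y-reads-z j) β-reads-yd (<-trans z<y (≤-reflexive (sym yd≡1+yj))))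
      where
      j≢d : j ≢ d
      j≢d refl = <-irrefl refl (≤-reflexive (sym yd≡1+yj))
      z<y : pos (z j) < pos (y j)
      z<y = z-before-y-right-before-y j≢d yd≡1+yj
      β-reads-yd : Reads (∅ ∪⁅ y j ⁆) (y d)
      β-reads-yd = y-reads-other-pair j≢d true y<z
      from-edge : (∃ λ v → Edge (z j) false v × pos (z j) < pos v × pos v ≤ pos (y d)) → ⊥
      from-edge (v , z→v , z<v , v≤yd) with m≤n⇒m<n∨m≡n v≤yd
      ... | inj₂ v≡yd = z-false-edge-avoids-y adj j (subst (Edge (z j) false) (pos-injective v≡yd) z→v)
      ... | inj₁ v<yd = later-y-unread z<y (reads-y (m≤n⇒m<n∨m≡n (s≤s⁻¹ (subst (pos v <_) yd≡1+yj v<yd))))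
        where
        β-reads-v : Reads (∅ ∪⁅ y j ⁆) v
        β-reads-v = reads-edge (y-reads-z j) z→v
        reads-y : pos v < pos (y j) ⊎ pos v ≡ pos (y j) → Reads (∅ ∪⁅ y j ⁆) (y j)
        reads-y (inj₂ v≡yj) = subst (Reads _) (pos-injective v≡yj) β-reads-v
        reads-y (inj₁ v<yj) with only-x-inside-pair j false v z<v v<yj
        ... | i , refl = reads-along (allZ-reads-non-z (x i) λ _ ()) (allZ-reads-non-z (y j) λ _ ()) (<⇒≤ v<yj) β-reads-v
                           λ w v≤w w<yj → agree-on-x (only-x-inside-pair j false w (<-≤-trans z<v v≤w) w<yj)
          where
          agree-on-x : ∀ {w} → ∃ (λ i → w ≡ x i) → allZ w ≡ (∅ ∪⁅ y j ⁆) w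
          agree-on-x (_ , refl) = refl

    x-right-before-y : ∃ λ i → suc (pos (x i)) ≡ pos (y d)
    x-right-before-y with first-or-after (y d)
    ... | inj₁ first     = ⊥-elim (allX-avoids-y adj (reads-first first))
    ... | inj₂ (x i , e) = i , sym e
    ... | inj₂ (y j , e) = ⊥-elim (no-y-right-before e)
    ... | inj₂ (z j , e) = ⊥-elim (no-z-right-before e)

  y-false-edge-within : ∀ {d k} → d ≢ k → pos (y d) < pos (y k) →
                        ∃ λ v → Edge (y d) false v × pos (y d) < pos v × pos v ≤ pos (y k)
  y-false-edge-within d≢k = edge-within (proj₁ (zz-reads-yy d≢k)) (proj₂ (zz-reads-yy d≢k))

  z-false-edge-within : ∀ {d e} → d ≢ e → pos (z d) < pos (y e) →
                        ∃ λ v → Edge (z d) false v × pos (z d) < pos v × pos v ≤ pos (y e)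
  z-false-edge-within {d} {e} d≢e zd<ye
    with edge-within (proj₁ (reads-flip a (z d) γa γa+zd)) (proj₁ (reads-flip a (y e) γa γa+ye)) zd<ye
    where
    a : Input n
    a = ∅ ∪⁅ y d ⁆ ∪⁅ z e ⁆
    γa : gamma' n a ≡ just false
    γa = noX-false a (λ _ → refl) (incomplete-pair (y d) (z e) d≢e)
    γa+zd : gamma' n (a ∪⁅ z d ⁆) ≡ just true
    γa+zd = noX-true (a ∪⁅ z d ⁆) (λ _ → refl) d (∪-self ∅ (y d)) (∪-self a (z d))
    γa+ye : gamma' n (a ∪⁅ y e ⁆) ≡ just true
    γa+ye = noX-true (a ∪⁅ y e ⁆) (λ _ → refl) e (∪-self a (y e)) (∪-self (∅ ∪⁅ y d ⁆) (z e))
  ... | v , z→v , bounds =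
    v , subst (λ b → Edge (z d) b v) (∪-other (∅ ∪⁅ y d ⁆) {z e} {z d} λ { refl → d≢e refl }) z→v , bounds

  y-before-z-right-after-zy : ∀ {d k} → d ≢ k → pos (y d) ≡ suc (pos (z d)) → pos (y k) ≡ suc (pos (y d)) →
                              pos (y k) < pos (z k)
  y-before-z-right-after-zy {d} {k} d≢k yd≡1+zd yk≡1+yd with <-cmp (pos (y k)) (pos (z k))
  ... | tri< y<z _ _ = y<z
  ... | tri≈ _ y≡z _ with () ← pos-injective y≡z
  ... | tri> _ _ z<y = ⊥-elim (pairs-unnested (λ k≡d → d≢k (sym k≡d)) false false zk<zd (<-trans zd<yd yd<yk))
    where
    zd<yd : pos (z d) < pos (y d)
    zd<yd = ≤-reflexive (sym yd≡1+zd)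
    yd<yk : pos (y d) < pos (y k)
    yd<yk = ≤-reflexive (sym yk≡1+yd)
    zk<yd : pos (z k) < pos (y d)
    zk<yd = ≤∧≢⇒< (s≤s⁻¹ (subst (pos (z k) <_) yk≡1+yd z<y)) λ zk≡yd → z≢y (pos-injective zk≡yd)
      where z≢y : z k ≢ y d
            z≢y ()
    zk<zd : pos (z k) < pos (z d)
    zk<zd = ≤∧≢⇒< (s≤s⁻¹ (subst (pos (z k) <_) yd≡1+zd zk<yd))
                  λ zk≡zd → d≢k (sym (cong index (pos-injective zk≡zd)))

  module AdjacentZY {d} (adj : pos (y d) ≡ suc (pos (z d))) where

    z<y : pos (z d) < pos (y d)
    z<y = ≤-reflexive (sym adj)

    δ : Input n
    δ = allX ∪⁅ z d ⁆

    value-δ : gamma' n δ ≡ just true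
    value-δ = allX-true δ (λ _ → refl) d (∪-self allX (z d))

    δ-reads-y : Reads δ (y d)
    δ-reads-y = reads-edge (proj₂ (reads-flip allX (z d) value-allX value-δ)) (edge-adjacent ε-reads-z ε-reads-y adj)
      where
      ε-reads-z : Reads (∅ ∪⁅ z d ⁆ ∪⁅ y d ⁆) (z d)
      ε-reads-z = proj₂ (reads-flip-under ∅ (z d) (y d) (value-y d) (value-zy d))
      ε-reads-y : Reads (∅ ∪⁅ z d ⁆ ∪⁅ y d ⁆) (y d)
      ε-reads-y = proj₂ (reads-flip (∅ ∪⁅ z d ⁆) (y d) (value-z d) (value-zy d))

    δ+y-reads-y : ∀ {k} → Reads δ (y k) → Reads (allX ∪⁅ y k ⁆ ∪⁅ z d ⁆) (y k)
    δ+y-reads-y {k} δ-reads = reads-transfer δ-reads (∪-cong-differOnlyAt (z d) (∪-differOnlyAt allX (y k))) ≤-refl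

    no-common-read-after-z : ∀ {a v} → AllX a → (∀ i → a (z i) ≡ false) →
                             Reads a v → Reads (a ∪⁅ z d ⁆) v → pos (z d) < pos v → ⊥
    no-common-read-after-z {a} all-x no-z ra ra+z z<v = false≢true
      (same-value-if-differ-before ra ra+z (∪-differOnlyAt a (z d)) z<v
        (allX-false a all-x no-z) (allX-true (a ∪⁅ z d ⁆) all-x d (∪-self a (z d))))

    y-not-last : ¬ (∀ w → pos (y d) ≤ pos w → w ≡ y d)
    y-not-last last = false≢true (same-value-after ε-reads-y δ-reads-y agree (value-z d) value-δ)
      where
      ε-reads-y : Reads (∅ ∪⁅ z d ⁆) (y d)
      ε-reads-y = proj₁ (reads-flip (∅ ∪⁅ z d ⁆) (y d) (value-z d) (value-zy d))
      agree : ∀ w → pos (y d) ≤ pos w → (∅ ∪⁅ z d ⁆) w ≡ δ w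
      agree w y≤w with last w y≤w
      ... | refl = refl

    no-z-right-after : ∀ {k} → pos (z k) ≡ suc (pos (y d)) → ⊥
    no-z-right-after {k} zk≡1+yd =
      no-common-read-after-z (λ _ → refl) (λ _ → refl) (allX-reads-z k) (reads-edge δ-reads-y y→z) zd<zk
      where
      zd<zk : pos (z d) < pos (z k)
      zd<zk = <-trans z<y (≤-reflexive (sym zk≡1+yd))
      d≢k : d ≢ k
      d≢k refl = <-irrefl refl zd<zk
      a : Input n
      a = ∅ ∪⁅ z d ⁆ ∪⁅ y k ⁆
      γa : gamma' n a ≡ just false
      γa = noX-false a (λ _ → refl) (incomplete-pair (z d) (y k) d≢k)
      γa+yd : gamma' n (a ∪⁅ y d ⁆) ≡ just true
      γa+yd = noX-true (a ∪⁅ y d ⁆) (λ _ → refl) d (∪-self a (y d)) (∪-self ∅ (z d))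
      γa+zk : gamma' n (a ∪⁅ z k ⁆) ≡ just true
      γa+zk = noX-true (a ∪⁅ z k ⁆) (λ _ → refl) k (∪-self (∅ ∪⁅ z d ⁆) (y k)) (∪-self a (z k))
      y→z : Edge (y d) false (z k)
      y→z = subst (λ b → Edge (y d) b (z k)) (∪-other (∅ ∪⁅ z d ⁆) {y k} {y d} λ { refl → d≢k refl })
              (edge-adjacent (proj₁ (reads-flip a (y d) γa γa+yd)) (proj₁ (reads-flip a (z k) γa γa+zk)) zk≡1+yd)

    -- From z d up to y k there are only z d and y d, on which allX ∪ y k agrees with ∅ ∪ y k; so allX ∪ y k
    -- reads y k, and so does allX ∪ y k ∪ z d, which differs from it only at z d.
    no-y-right-after : ∀ {k} → pos (y k) ≡ suc (pos (y d)) → ⊥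
    no-y-right-after {k} yk≡1+yd =
      no-common-read-after-z (λ _ → refl) (λ _ → refl) α-reads-y (δ+y-reads-y (reads-edge δ-reads-y y→y)) zd<yk
      where
      d≢k : d ≢ k
      d≢k refl = <-irrefl refl (≤-reflexive (sym yk≡1+yd))
      zd<yk : pos (z d) < pos (y k)
      zd<yk = <-trans z<y (≤-reflexive (sym yk≡1+yd))
      y→y : Edge (y d) false (y k)
      y→y = edge-adjacent (proj₁ (zz-reads-yy d≢k)) (proj₂ (zz-reads-yy d≢k)) yk≡1+yd
      agree : ∀ w → pos (z d) ≤ pos w → pos w < pos (y k) → (∅ ∪⁅ y k ⁆) w ≡ (allX ∪⁅ y k ⁆) w
      agree w z≤w w<yk with m≤n⇒m<n∨m≡n z≤w
      ... | inj₂ z≡w with refl ← pos-injective z≡w = refl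
      ... | inj₁ z<w
        with refl ← pos-injective {w} {y d} (≤-antisym (s≤s⁻¹ (subst (pos w <_) yk≡1+yd w<yk)) (subst (_≤ pos w) (sym adj) z<w))
        = refl
      α-reads-y : Reads (allX ∪⁅ y k ⁆) (y k)
      α-reads-y = reads-along (y-reads-other-pair (λ k≡d → d≢k (sym k≡d)) false z<y)
                              (y-reads-own-y (y-before-z-right-after-zy d≢k adj yk≡1+yd)) (<⇒≤ zd<yk)
                              (reads-z-without-z (allX ∪⁅ y k ⁆) (λ _ → refl) (λ _ → refl) d) agree

    x-right-after-y : ∃ λ i → pos (x i) ≡ suc (pos (y d))
    x-right-after-y with last-or-before (y d)
    ... | inj₁ last      = ⊥-elim (y-not-last last)
    ... | inj₂ (x i , e) = i , e
    ... | inj₂ (y k , e) = ⊥-elim (no-y-right-after e)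
    ... | inj₂ (z k , e) = ⊥-elim (no-z-right-after e)

    δ-avoids-adjacent-yz : ∀ {e} → pos (z e) ≡ suc (pos (y e)) → pos (z d) < pos (y e) → ¬ Reads δ (y e)
    δ-avoids-adjacent-yz {e} ze≡1+ye zd<ye δ-reads-ye =
      no-common-read-after-z (λ _ → refl) (λ _ → refl) (reads-z-without-z (allX ∪⁅ y e ⁆) (λ _ → refl) (λ _ → refl) e)
                             δ+y-reads-z (<-trans zd<ye (≤-reflexive (sym ze≡1+ye)))
      where
      δ+y-reads-z : Reads (allX ∪⁅ y e ⁆ ∪⁅ z d ⁆) (z e)
      δ+y-reads-z = reads-edge (δ+y-reads-y δ-reads-ye)
                      (edge-adjacent (proj₂ (reads-flip-under ∅ (y e) (z e) (value-z e) (value-yz e)))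
                                     (proj₂ (reads-flip (∅ ∪⁅ y e ⁆) (z e) (value-y e) (value-yz e))) ze≡1+ye)

    no-shared-x : ∀ {i e} → pos (x i) ≡ suc (pos (y d)) → pos (y e) ≡ suc (pos (x i)) →
                  pos (z e) ≡ suc (pos (y e)) → ⊥
    no-shared-x {i} {e} xi≡1+yd ye≡1+xi ze≡1+ye = from-y-edge (y-false-edge-within d≢e yd<ye)
      where
      ye≡2+yd : pos (y e) ≡ 2 + pos (y d)
      ye≡2+yd = trans ye≡1+xi (cong suc xi≡1+yd)
      ye≡3+zd : pos (y e) ≡ 3 + pos (z d)
      ye≡3+zd = trans ye≡2+yd (cong (2 +_) adj)
      yd<ye : pos (y d) < pos (y e)
      yd<ye = subst (pos (y d) <_) (sym ye≡2+yd) (m<n+m (pos (y d)) {2} z<s)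
      d≢e : d ≢ e
      d≢e refl = <-irrefl refl yd<ye
      zd<ye : pos (z d) < pos (y e)
      zd<ye = <-trans z<y yd<ye
      from-z-edge : (∃ λ v → Edge (z d) false v × pos (z d) < pos v × pos v ≤ pos (y e)) → Reads δ (x i) → ⊥
      from-z-edge (v , z→v , zd<v , v≤ye) δ-reads-x with three-after zd<v (subst (pos v ≤_) ye≡3+zd v≤ye)
      ... | inj₁ v≡1+zd with refl ← pos-injective {v} {y d} (trans v≡1+zd (sym adj)) =
        no-common-read-after-z (λ _ → refl) (λ _ → refl) (reads-edge (allX-reads-z d) z→v) δ-reads-y z<y
      ... | inj₂ (inj₁ v≡2+zd) with refl ← pos-injective {v} {x i} (trans v≡2+zd (sym (trans xi≡1+yd (cong suc adj)))) =
        no-common-read-after-z (λ _ → refl) (λ _ → refl) (reads-edge (allX-reads-z d) z→v) δ-reads-x zd<v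
      ... | inj₂ (inj₂ v≡3+zd) with refl ← pos-injective {v} {y e} (trans v≡3+zd (sym ye≡3+zd)) =
        adjacent-yz-unread ze≡1+ye (reads-edge (allX-reads-z d) z→v) refl (allX-reads-z e)
      from-y-edge : (∃ λ v → Edge (y d) false v × pos (y d) < pos v × pos v ≤ pos (y e)) → ⊥
      from-y-edge (v , y→v , yd<v , v≤ye) with two-after yd<v (subst (pos v ≤_) ye≡2+yd v≤ye)
      ... | inj₂ v≡2+yd with refl ← pos-injective {v} {y e} (trans v≡2+yd (sym ye≡2+yd)) =
        δ-avoids-adjacent-yz ze≡1+ye zd<ye (reads-edge δ-reads-y y→v)
      ... | inj₁ v≡1+yd with refl ← pos-injective {v} {x i} (trans v≡1+yd (sym xi≡1+yd)) =
        from-z-edge (z-false-edge-within d≢e zd<ye) (reads-edge δ-reads-y y→v)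

module Arrangement {n : ℕ} (pos : Var n → ℕ)
  (pos-injective : ∀ {v w} → pos v ≡ pos w → v ≡ w)
  (pos<n*3 : ∀ v → pos v < n * 3)
  (var-at : ∀ {q} → q < n * 3 → ∃ λ v → pos v ≡ q)
  (pairs-unnested : ∀ {d j} → d ≢ j → ∀ s t → pos (pv d s) < pos (pv j t) → pos (pv j t) < pos (pv d (not s)) → ⊥)
  (x-right-before-yz : ∀ {d} → pos (z d) ≡ suc (pos (y d)) → ∃ λ i → suc (pos (x i)) ≡ pos (y d))
  (x-right-after-zy : ∀ {d} → pos (y d) ≡ suc (pos (z d)) → ∃ λ i → pos (x i) ≡ suc (pos (y d)))
  (no-shared-x : ∀ {d i e} → pos (y d) ≡ suc (pos (z d)) → pos (x i) ≡ suc (pos (y d)) →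
                 pos (y e) ≡ suc (pos (x i)) → pos (z e) ≡ suc (pos (y e)) → ⊥)
  where
  open Unnested pos pairs-unnested

  x-between : ∀ j s {q} → pos (pv j s) < q → q < pos (pv j (not s)) → ∃ λ i → pos (x i) ≡ q
  x-between j s l r with var-at (<-trans r (pos<n*3 (pv j (not s))))
  ... | w , w≡q with only-x-inside-pair j s w (subst (pos (pv j s) <_) (sym w≡q) l) (subst (_< pos (pv j (not s))) (sym w≡q) r)
  ...   | i , refl = i , w≡q

  data Kind (j i : Fin n) : Set where
    x-y-z    : pos (z j) ≡ suc (pos (y j)) → suc (pos (x i)) ≡ pos (y j) → Kind j i
    z-y-x    : pos (y j) ≡ suc (pos (z j)) → pos (x i) ≡ suc (pos (y j)) → Kind j i
    straddle : ∀ s → suc (pos (pv j s)) < pos (pv j (not s)) → pos (x i) ≡ suc (pos (pv j s)) → Kind j i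

  kind : ∀ j → ∃ (Kind j)
  kind j with <-cmp (pos (y j)) (pos (z j))
  ... | tri≈ _ y≡z _ with () ← pos-injective y≡z
  ... | tri< y<z _ _ with m≤n⇒m<n∨m≡n y<z
  ...   | inj₂ 1+y≡z = let i , e = x-right-before-yz (sym 1+y≡z) in i , x-y-z (sym 1+y≡z) e
  ...   | inj₁ 1+y<z = let i , e = x-between j true ≤-refl 1+y<z in i , straddle true 1+y<z e
  kind j | tri> _ _ z<y with m≤n⇒m<n∨m≡n z<y
  ...   | inj₂ 1+z≡y = let i , e = x-right-after-zy (sym 1+z≡y) in i , z-y-x (sym 1+z≡y) e
  ...   | inj₁ 1+z<y = let i , e = x-between j false ≤-refl 1+z<y in i , straddle false 1+z<y e

  ψ : Fin n → Fin n
  ψ j = proj₁ (kind j)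

  ψ-kind : ∀ j → Kind j (ψ j)
  ψ-kind j = proj₂ (kind j)

  straddle-x-y-z : ∀ {j k i} s → suc (pos (pv j s)) < pos (pv j (not s)) → pos (x i) ≡ suc (pos (pv j s)) →
                   suc (pos (x i)) ≡ pos (y k) → j ≡ k
  straddle-x-y-z {j} {k} s l x≡1+s 1+x≡yk with j Fin.≟ k
  ... | yes j≡k = j≡k
  ... | no  j≢k = ⊥-elim (pairs-unnested j≢k s true s<yk yk<s̄)
    where
    yk≡2+s : pos (y k) ≡ 2 + pos (pv j s)
    yk≡2+s = trans (sym 1+x≡yk) (cong suc x≡1+s)
    s<yk : pos (pv j s) < pos (y k)
    s<yk = subst (pos (pv j s) <_) (sym yk≡2+s) (m<n+m (pos (pv j s)) {2} z<s)
    yk<s̄ : pos (y k) < pos (pv j (not s))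
    yk<s̄ = ≤∧≢⇒< (subst (_≤ pos (pv j (not s))) (sym yk≡2+s) l)
                  λ yk≡s̄ → j≢k (sym (pv-index (pos-injective yk≡s̄)))

  shared-x : ∀ {j k i} → Kind j i → Kind k i → j ≡ k
  shared-x (x-y-z _ xj)      (x-y-z _ xk)      = cong index (pos-injective (trans (sym xj) xk))
  shared-x (z-y-x _ xj)      (z-y-x _ xk)      = cong index (pos-injective (suc-injective (trans (sym xj) xk)))
  shared-x (straddle _ _ xj) (straddle _ _ xk) = pv-index (pos-injective (suc-injective (trans (sym xj) xk)))
  shared-x (straddle _ _ xj) (z-y-x _ xk)      = pv-index {t = true} (pos-injective (suc-injective (trans (sym xj) xk)))
  shared-x (z-y-x _ xj)      (straddle _ _ xk) = pv-index {s = true} (pos-injective (suc-injective (trans (sym xj) xk)))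
  shared-x (x-y-z zj xj)     (z-y-x yk xk)     = ⊥-elim (no-shared-x yk xk (sym xj) zj)
  shared-x (z-y-x yj xj)     (x-y-z zk xk)     = ⊥-elim (no-shared-x yj xj (sym xk) zk)
  shared-x (straddle s l xj) (x-y-z _ xk)      = straddle-x-y-z s l xj xk
  shared-x (x-y-z _ xj)      (straddle t l xk) = sym (straddle-x-y-z t l xk xj)

  ψ-injective : Injective _≡_ _≡_ ψ
  ψ-injective {j} {k} ψj≡ψk = shared-x (ψ-kind j) (subst (Kind k) (sym ψj≡ψk) (ψ-kind k))

  ψ-surjective : ∀ i → ∃ λ j → ψ j ≡ i
  ψ-surjective = injective⇒surjective ψ ψ-injective

  -- A second x inside the pair j would have to be ψ k for another pair k, and no kind allows that.
  straddle-width : ∀ j s → suc (pos (pv j s)) < pos (pv j (not s)) → pos (x (ψ j)) ≡ suc (pos (pv j s)) →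
                   pos (pv j (not s)) ≡ 2 + pos (pv j s)
  straddle-width j s l x≡1+s with m≤n⇒m<n∨m≡n l
  ... | inj₂ 2+s≡s̄ = sym 2+s≡s̄
  ... | inj₁ 2+s<s̄ with x-between j s (m<n+m (pos (pv j s)) {2} z<s) 2+s<s̄
  ...   | i , x′≡2+s with ψ-surjective i
  ...     | k , refl = ⊥-elim (second-x (ψ-kind k))
    where
    k≢j : k ≢ j
    k≢j refl = <-irrefl (trans (sym x≡1+s) x′≡2+s) (n<1+n _)
    right-before-x′ : ∀ v → suc (pos v) ≡ pos (x (ψ k)) → v ≡ x (ψ j)
    right-before-x′ v e = pos-injective (suc-injective (trans e (trans x′≡2+s (cong suc (sym x≡1+s)))))
    second-x : Kind k (ψ k) → ⊥
    second-x (x-y-z _ xk) = pairs-unnested (λ j≡k → k≢j (sym j≡k)) s true s<yk yk<s̄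
      where
      yk≡3+s : pos (y k) ≡ 3 + pos (pv j s)
      yk≡3+s = trans (sym xk) (cong suc x′≡2+s)
      s<yk : pos (pv j s) < pos (y k)
      s<yk = subst (pos (pv j s) <_) (sym yk≡3+s) (m<n+m (pos (pv j s)) {3} z<s)
      yk<s̄ : pos (y k) < pos (pv j (not s))
      yk<s̄ = ≤∧≢⇒< (subst (_≤ pos (pv j (not s))) (sym yk≡3+s) 2+s<s̄)
                    λ yk≡s̄ → k≢j (pv-index (pos-injective yk≡s̄))
    second-x (z-y-x _ xk)          with () ← right-before-x′ (y k) (sym xk)
    second-x (straddle true  _ xk) with () ← right-before-x′ (y k) (sym xk)
    second-x (straddle false _ xk) with () ← right-before-x′ (z k) (sym xk)

  Member : Fin n → Var n → Set
  Member j v = InTriple v (x (ψ j)) (y j) (z j)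

  member-pv : ∀ j s → Member j (pv j s)
  member-pv j true  = inj₂ (inj₁ refl)
  member-pv j false = inj₂ (inj₂ refl)

  owner : ∀ v → ∃ λ j → Member j v
  owner (x i) = let j , ψj≡i = ψ-surjective i in j , inj₁ (cong x (sym ψj≡i))
  owner (y j) = j , member-pv j true
  owner (z j) = j , member-pv j false

  owner-unique : ∀ {j k v} → Member j v → Member k v → j ≡ k
  owner-unique (inj₁ refl)        (inj₁ e)         = ψ-injective (cong index e)
  owner-unique (inj₂ (inj₁ refl)) (inj₂ (inj₁ e))  = cong index e
  owner-unique (inj₂ (inj₂ refl)) (inj₂ (inj₂ e))  = cong index e
  owner-unique (inj₁ refl)        (inj₂ (inj₁ ()))
  owner-unique (inj₁ refl)        (inj₂ (inj₂ ()))
  owner-unique (inj₂ (inj₁ refl)) (inj₁ ())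
  owner-unique (inj₂ (inj₁ refl)) (inj₂ (inj₂ ()))
  owner-unique (inj₂ (inj₂ refl)) (inj₁ ())
  owner-unique (inj₂ (inj₂ refl)) (inj₂ (inj₁ ()))

  record Window (j : Fin n) : Set where
    field
      start  : ℕ
      within : ∀ v → Member j v → start ≤ pos v × pos v < 3 + start
      filled : ∀ q → start ≤ q → q < 3 + start → ∃ λ v → Member j v × pos v ≡ q

  consecutive-window : ∀ {j} u v w → Member j u → Member j v → Member j w →
                       pos v ≡ suc (pos u) → pos w ≡ suc (pos v) → (∀ t → Member j t → InTriple t u v w) → Window j
  consecutive-window {j} u v w mu mv mw v≡1+u w≡1+v members = record { start = pos u ; within = within ; filled = filled }
    where
    w≡2+u : pos w ≡ 2 + pos u
    w≡2+u = trans w≡1+v (cong suc v≡1+u)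
    within : ∀ t → Member j t → pos u ≤ pos t × pos t < 3 + pos u
    within t mt with members t mt
    ... | inj₁ refl        = ≤-refl , m<n+m (pos u) {3} z<s
    ... | inj₂ (inj₁ refl) = subst (pos u ≤_) (sym v≡1+u) (n≤1+n _)
                           , subst (_< 3 + pos u) (sym v≡1+u) (m<n+m (suc (pos u)) {2} z<s)
    ... | inj₂ (inj₂ refl) = subst (pos u ≤_) (sym w≡2+u) (m≤n+m (pos u) 2) , subst (_< 3 + pos u) (sym w≡2+u) ≤-refl
    filled : ∀ q → pos u ≤ q → q < 3 + pos u → ∃ λ t → Member j t × pos t ≡ q
    filled q u≤q q<3+u with m≤n⇒m<n∨m≡n u≤q
    ... | inj₂ u≡q = u , mu , u≡q
    ... | inj₁ u<q with m≤n⇒m<n∨m≡n u<q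
    ...   | inj₂ 1+u≡q = v , mv , trans v≡1+u 1+u≡q
    ...   | inj₁ 1+u<q = w , mw , trans w≡2+u (≤-antisym 1+u<q (s≤s⁻¹ q<3+u))

  window : ∀ j → Window j
  window j with ψ-kind j
  ... | x-y-z z≡1+y 1+x≡y =
    consecutive-window (x (ψ j)) (y j) (z j) (inj₁ refl) (member-pv j true) (member-pv j false) (sym 1+x≡y) z≡1+y (λ _ m → m)
  ... | z-y-x y≡1+z x≡1+y =
    consecutive-window (z j) (y j) (x (ψ j)) (member-pv j false) (member-pv j true) (inj₁ refl) y≡1+z x≡1+y
      λ { _ (inj₁ refl)        → inj₂ (inj₂ refl)
        ; _ (inj₂ (inj₁ refl)) → inj₂ (inj₁ refl)
        ; _ (inj₂ (inj₂ refl)) → inj₁ refl }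
  ... | straddle s l x≡1+s =
    consecutive-window (pv j s) (x (ψ j)) (pv j (not s)) (member-pv j s) (inj₁ refl) (member-pv j (not s))
      x≡1+s (trans (straddle-width j s l x≡1+s) (cong suc (sym x≡1+s))) (reorder s)
    where
    reorder : ∀ s t → Member j t → InTriple t (pv j s) (x (ψ j)) (pv j (not s))
    reorder s     _ (inj₁ refl)        = inj₂ (inj₁ refl)
    reorder true  _ (inj₂ (inj₁ refl)) = inj₁ refl
    reorder false _ (inj₂ (inj₁ refl)) = inj₂ (inj₂ refl)
    reorder true  _ (inj₂ (inj₂ refl)) = inj₂ (inj₂ refl)
    reorder false _ (inj₂ (inj₂ refl)) = inj₁ refl

  open Window

  aligned : ∀ i → i < n → ∃ λ j → start (window j) ≡ 3 * i
  aligned = aligned-windows 2 (λ j → start (window j)) cover unique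
    where
    cover : ∀ q → q < n * 3 → ∃ λ j → start (window j) ≤ q × q < 3 + start (window j)
    cover q q<3n with var-at q<3n
    ... | v , refl with owner v
    ...   | j , m = j , within (window j) v m
    unique : ∀ {j k q} → start (window j) ≤ q → q < 3 + start (window j) →
             start (window k) ≤ q → q < 3 + start (window k) → j ≡ k
    unique {j} {k} {q} l r l′ r′ with filled (window j) q l r | filled (window k) q l′ r′
    ... | v , mv , refl | w , mw , w≡v = owner-unique mv (subst (Member k) (pos-injective w≡v) mw)

module Tiling {n : ℕ} (B : BP n (n * 3)) (oa : OnceAppearance B) (comp : Computes B (gamma' n)) where
  open Reading B oa comp
  open Ordering B oa comp
  open Arrangement pos pos-injective pos<n*3 var-at pairs-unnested
                   AdjacentYZ.x-right-before-y AdjacentZY.x-right-after-y (λ adj → AdjacentZY.no-shared-x adj) public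
  open Window

  block-of-window : ∀ i j → start (window j) ≡ 3 * toℕ i → BlockIs B i (ψ j) j
  block-of-window i j s≡3i = members , in-block (inj₁ refl) , in-block (member-pv j true) , in-block (member-pv j false)
    where
    s : ℕ
    s = start (window j)
    offset : ∀ k → toℕ (combine i k) ≡ s + toℕ k
    offset k = trans (toℕ-combine i k) (cong (_+ toℕ k) (sym s≡3i))
    members : ∀ k → InTriple (label B (combine i k)) (x (ψ j)) (y j) (z j)
    members k with filled (window j) (toℕ (combine i k)) (subst (s ≤_) (sym (offset k)) (m≤m+n s (toℕ k)))
                     (subst (_< 3 + s) (sym (offset k)) (subst (s + toℕ k <_) (+-comm s 3) (+-monoʳ-< s (toℕ<n k))))
    ... | v , mv , v≡ = subst (λ w → Member j w) (sym (label-at (sym v≡))) mv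
    in-block : ∀ {v} → Member j v → InBlock B i v
    in-block {v} mv with within (window j) v mv
    ... | s≤v , v<3+s =
      fromℕ< v-s<3 , label-at (trans (offset (fromℕ< v-s<3)) (trans (cong (s +_) (toℕ-fromℕ< v-s<3)) (m+[n∸m]≡n s≤v)))
      where
      v-s<3 : pos v ∸ s < 3
      v-s<3 = m<n+o⇒m∸n<o (pos v) s (subst (pos v <_) (+-comm 3 s) v<3+s)

lemma1 : ∀ (n : ℕ) (B : BP n (n * 3)) → OnceAppearance B → Computes B (gamma' n) →
    ∀ (i : Fin n) → ∃[ a ] ∃[ b ] BlockIs B i a b
lemma1 n B oa comp i =
  let j , start≡3i = aligned (toℕ i) (toℕ<n i)
  in ψ j , j , block-of-window i j start≡3i
  where open Tiling B oa comp
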